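{- Let $n\ge 6$, let $L$ be a 3-uniform list assignment of $\Pi_n$, and let $c$ be a proper lex-min $L$-coloring of $\Pi_n$. If $c$ is not $\lceil 2n/3\rceil$-bounded (i.e. some color class has more than $\lceil 2n/3\rceil$ vertices), then $c$ uses at least 4 distinct colors.
   Context: $\Pi_n=C_n\square K_2$ has vertices $u_1,\dots,u_n,v_1,\dots,v_n$ and edges $u_iu_{i+1}$, $v_iv_{i+1}$ (indices mod $n$) and $u_iv_i$. A 3-uniform list assignment gives each vertex a set $L(v)$ of exactly 3 colors; a proper $L$-coloring is a proper coloring with $c(v)\in L(v)$. For a proper $L$-coloring $c$ with nonempty color classes $C_1,\dots,C_r$ ordered so that $|C_1|\ge\cdots\ge|C_r|$, the color word is $w_c=n_1\cdots n_r$ with $n_i=|C_i|$. The coloring $c$ is lex-min if for every proper $L$-coloring $c'$ with color word $m_1\cdots m_s$, either $w_c=w_{c'}$ or there is $k$ ($1\le k\le s$) with $n_i=m_i$ for $i<k$ and $n_k<m_k$. -}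

module Defs where

open import Data.Nat using (ℕ; zero; suc; _+_; _*_; _≤_; _<_; _≟_)
open import Data.Nat.DivMod using (_/_)
open import Data.Nat.Properties using (≤-decTotalOrder)
open import Data.Bool using (Bool; true; false)
open import Data.Fin using (Fin; toℕ)
open import Data.Product using (_×_; _,_; ∃-syntax)
open import Data.Sum using (_⊎_)
open import Data.List using (List; []; _∷_; length; map; filter; allFin; cartesianProduct; deduplicate; reverse)
open import Data.List.Membership.Propositional using (_∈_)
open import Data.List.Relation.Unary.Unique.Propositional using (Unique)
open import Relation.Binary.PropositionalEquality using (_≡_; _≢_)
import Data.List.Sort as Sort

-- Vertices of the prism Π_n = C_n □ K_2 :
-- (false , i) is u_{i+1}, (true , i) is v_{i+1}  (i : Fin n, 0-based).
V : ℕ → Set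
V n = Bool × Fin n

vertices : (n : ℕ) → List (V n)
vertices n = cartesianProduct (false ∷ true ∷ []) (allFin n)

CycSucc : (n : ℕ) → Fin n → Fin n → Set
CycSucc n i j = suc (toℕ i) ≡ toℕ j ⊎ (suc (toℕ i) ≡ n × toℕ j ≡ 0)

Adj : (n : ℕ) → V n → V n → Set
Adj n (a , i) (b , j) =
  (a ≡ b × (CycSucc n i j ⊎ CycSucc n j i)) ⊎ (a ≢ b × i ≡ j)

ThreeUniform : (n : ℕ) → (V n → List ℕ) → Set
ThreeUniform n L = ∀ v → length (L v) ≡ 3 × Unique (L v)

ProperLColoring : (n : ℕ) → (V n → List ℕ) → (V n → ℕ) → Set
ProperLColoring n L c =
  (∀ v → c v ∈ L v) × (∀ u v → Adj n u v → c u ≢ c v)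

colorClass : (n : ℕ) → (V n → ℕ) → ℕ → List (V n)
colorClass n c k = filter (λ v → c v ≟ k) (vertices n)

classSize : (n : ℕ) → (V n → ℕ) → ℕ → ℕ
classSize n c k = length (colorClass n c k)

usedColors : (n : ℕ) → (V n → ℕ) → List ℕ
usedColors n c = deduplicate _≟_ (map c (vertices n))

open Sort ≤-decTotalOrder using (sort)

colorWord : (n : ℕ) → (V n → ℕ) → List ℕ
colorWord n c = reverse (sort (map (classSize n c) (usedColors n c)))

data LexLess : List ℕ → List ℕ → Set where
  here  : ∀ {a b xs ys} → a < b → LexLess (a ∷ xs) (b ∷ ys)
  there : ∀ {a xs ys} → LexLess xs ys → LexLess (a ∷ xs) (a ∷ ys)

LexMin : (n : ℕ) → (V n → List ℕ) → (V n → ℕ) → Set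
LexMin n L c = ∀ c' → ProperLColoring n L c' →
  colorWord n c ≡ colorWord n c' ⊎ LexLess (colorWord n c) (colorWord n c')

-- ⌈2n/3⌉ = ⌊(2n+2)/3⌋
ceil2n/3 : ℕ → ℕ
ceil2n/3 n = (2 * n + 2) / 3

Bounded : (n : ℕ) → ℕ → (V n → ℕ) → Set
Bounded n B c = ∀ k → classSize n c k ≤ B

NotBounded : (n : ℕ) → ℕ → (V n → ℕ) → Set
NotBounded n B c = ∃[ k ] B < classSize n c k

-- Suppose c uses at most three colors and has a class of size s > ⌈2n/3⌉ ≥ 4.  Moving one
-- vertex from a class of size s into a class of size at most s − 2 leaves the numbers of classes
-- of size > s unchanged and lowers the number of size ≥ s, so it yields a lexicographically
-- smaller color word; lex-minimality forbids every such proper recoloring.  Hence the list of a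
-- vertex in a class of size ≥ 2 contains only used colors, and being a 3-set it is the set of
-- used colors.  Singleton classes {y} cannot occur either: y has only three neighbors, so some
-- vertex x of the big class is not adjacent to y and could take the color of y.  Thus all lists
-- are the same 3-set, and giving the i-th vertex of the u-cycle color i mod 3 and the i-th vertex
-- of the v-cycle color i + 1 mod 3 (correcting the last u-vertex when n ≡ 1 mod 3) is a proper
-- L-coloring with all classes of size ≤ ⌈2n/3⌉, whose color word is lexicographically smaller
-- than that of c.
module Submission where

open import Level using (0ℓ)
open import Function using (id; _∘_)
open import Data.Empty using (⊥; ⊥-elim)
open import Data.Bool using (Bool; true; false; not; if_then_else_)
import Data.Bool as Bool
open import Data.Product using (_×_; _,_; ∃-syntax; proj₁; proj₂)
open import Data.Product.Properties using (≡-dec)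
open import Data.Sum using (_⊎_; inj₁; inj₂)
open import Data.Nat using (ℕ; zero; suc; _+_; _*_; _∸_; _≤_; _<_; _≥_; _≟_; _≤?_; _<?_; z≤n; s≤s; z<s; s<s; NonZero)
open import Data.Nat.Properties
open import Data.Nat.DivMod using (_/_; _%_; m*n/n≡m; /-monoˡ-≤; m≡m%n+[m/n]*n; m%n<n)
open import Data.Nat.ListAction using (sum)
open import Data.Nat.Tactic.RingSolver using (solve-∀)
open import Algebra.Properties.CommutativeSemigroup +-commutativeSemigroup using (interchange)
open import Data.Fin using (toℕ)
import Data.Fin as Fin
open import Data.Fin.Properties using (toℕ-injective; toℕ<n)
open import Data.List using (List; []; _∷_; _++_; length; filter; map; reverseAcc; allFin; tabulate; deduplicate)
open import Data.List.Properties
  using (length-map; length-++; filter-++; map-tabulate; ++-identityʳ; filter-notAll; filter-accept; filter-none; filter-all)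
open import Data.List.Membership.Propositional using (_∈_; _∉_; find)
open import Data.List.Membership.Propositional.Properties
  using (∈-filter⁺; ∈-filter⁻; ∈-map⁺; ∈-map⁻; ∈-deduplicate⁺; ∈-deduplicate⁻; ∈-allFin; ∈-cartesianProduct⁺)
open import Data.List.Membership.Setoid.Properties using (∈-length)
import Data.List.Membership.DecPropositional
open import Data.List.Membership.DecPropositional _≟_ using (_∈?_)
open import Data.List.Relation.Unary.Any as Any using (here; there; any?)
open import Data.List.Relation.Unary.All as All using (All; []; _∷_)
import Data.List.Relation.Unary.All.Properties as Allₚ
open import Data.List.Relation.Unary.All.Properties.Core using (¬Any⇒All¬)
open import Data.List.Relation.Unary.AllPairs using (AllPairs; []; _∷_)
open import Data.List.Relation.Unary.Linked.Properties using (Linked⇒AllPairs)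
open import Data.List.Relation.Unary.Unique.Propositional using (Unique)
import Data.List.Relation.Unary.Unique.Propositional.Properties as Unique
open import Data.List.Relation.Unary.Unique.DecPropositional.Properties using (deduplicate-!)
open import Data.List.Relation.Binary.Subset.Propositional using (_⊆_)
open import Data.List.Relation.Binary.Subset.Propositional.Properties using (filter⁺′)
open import Data.List.Relation.Binary.Permutation.Propositional using (_↭_; ↭-trans; ↭-sym)
open import Data.List.Relation.Binary.Permutation.Propositional.Properties
  using (∈-resp-↭; ↭-length; ↭-reverse; filter-↭; All-resp-↭)
open import Data.List.Sort ≤-decTotalOrder using (sort-↭; sort-↗)
open import Relation.Binary.Definitions using (DecidableEquality; tri<; tri≈; tri>)
open import Relation.Binary.PropositionalEquality
  using (_≡_; _≢_; refl; sym; trans; cong; cong₂; subst; subst₂; setoid; ≢-sym; module ≡-Reasoning)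
open import Relation.Nullary using (¬_; Dec; yes; no; does; contradiction; ¬?)
open import Relation.Nullary.Decidable using (_×-dec_; _⊎-dec_; decidable-stable; dec-true; dec-false)
open import Relation.Unary using (Pred; Decidable)

open import Defs

𝟙[_] : {P : Set} → Dec P → ℕ
𝟙[ P? ] = if does P? then 1 else 0

𝟙-yes : ∀ {P : Set} (P? : Dec P) → P → 𝟙[ P? ] ≡ 1
𝟙-yes P? p rewrite dec-true P? p = refl

𝟙-no : ∀ {P : Set} (P? : Dec P) → ¬ P → 𝟙[ P? ] ≡ 0
𝟙-no P? ¬p rewrite dec-false P? ¬p = refl

length-filter-∷ : {A : Set} {P : Pred A 0ℓ} (P? : Decidable P) (x : A) (xs : List A) →
                  length (filter P? (x ∷ xs)) ≡ 𝟙[ P? x ] + length (filter P? xs)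
length-filter-∷ P? x xs with P? x
... | yes _ = refl
... | no _ = refl

module _ {A : Set} (_≟ᴬ_ : DecidableEquality A) where

  private
    module Dec∈ = Data.List.Membership.DecPropositional _≟ᴬ_

    _≢?_ : ∀ x → Decidable (x ≢_)
    (x ≢? y) = ¬? (x ≟ᴬ y)

  length-filter-≢ : ∀ {x ys} → x ∈ ys → length (filter (x ≢?_) ys) < length ys
  length-filter-≢ {ys = ys} x∈ys = filter-notAll (_ ≢?_) ys (Any.map (λ x≡y x≢y → x≢y x≡y) x∈ys)

  unique-⊆-∉⇒length< : ∀ {x xs ys} → Unique xs → xs ⊆ ys → x ∈ ys → x ∉ xs → length xs < length ys

  unique-⊆⇒length≤ : ∀ {xs ys} → Unique xs → xs ⊆ ys → length xs ≤ length ys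
  unique-⊆⇒length≤ {[]} _ _ = z≤n
  unique-⊆⇒length≤ {x ∷ xs} (x∉xs ∷ xs!) x∷xs⊆ys =
    unique-⊆-∉⇒length< xs! (λ y∈xs → x∷xs⊆ys (there y∈xs)) (x∷xs⊆ys (here refl)) (λ x∈xs → All.lookup x∉xs x∈xs refl)

  unique-⊆-∉⇒length< {x} {xs} {ys} xs! xs⊆ys x∈ys x∉xs = begin-strict
    length xs                  ≤⟨ unique-⊆⇒length≤ xs! xs⊆ys-x ⟩
    length (filter (x ≢?_) ys) <⟨ length-filter-≢ x∈ys ⟩
    length ys                  ∎
    where
    open ≤-Reasoning
    xs⊆ys-x : xs ⊆ filter (x ≢?_) ys
    xs⊆ys-x y∈xs = ∈-filter⁺ (x ≢?_) (xs⊆ys y∈xs) (λ where refl → x∉xs y∈xs)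

  unique-⊆-length≤⇒⊇ : ∀ {xs ys} → Unique xs → xs ⊆ ys → length ys ≤ length xs → ys ⊆ xs
  unique-⊆-length≤⇒⊇ {xs} xs! xs⊆ys ys≤xs {y} y∈ys with y Dec∈.∈? xs
  ... | yes y∈xs = y∈xs
  ... | no y∉xs = contradiction ys≤xs (<⇒≱ (unique-⊆-∉⇒length< xs! xs⊆ys y∈ys y∉xs))

module _ {A B : Set} {P : Pred B 0ℓ} (P? : Decidable P) (f : A → B) where

  length-filter-map : ∀ xs → length (filter P? (map f xs)) ≡ length (filter (λ x → P? (f x)) xs)
  length-filter-map [] = refl
  length-filter-map (x ∷ xs) = begin
    length (filter P? (map f (x ∷ xs)))                 ≡⟨ length-filter-∷ P? (f x) (map f xs) ⟩
    𝟙[ P? (f x) ] + length (filter P? (map f xs))       ≡⟨ cong (𝟙[ P? (f x) ] +_) (length-filter-map xs) ⟩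
    𝟙[ P? (f x) ] + length (filter (λ x → P? (f x)) xs) ≡⟨ length-filter-∷ (λ x → P? (f x)) x xs ⟨
    length (filter (λ x → P? (f x)) (x ∷ xs))           ∎
    where open ≡-Reasoning

module _ {A : Set} (f g : A → ℕ) (k : ℕ) where

  private
    count : (A → ℕ) → List A → ℕ
    count h l = length (filter (λ v → h v ≟ k) l)

  count-agree : ∀ {l} → (∀ {v} → v ∈ l → f v ≡ g v) → count f l ≡ count g l
  count-agree {[]} _ = refl
  count-agree {v ∷ l} f≡g = begin
    count f (v ∷ l)          ≡⟨ length-filter-∷ (λ v → f v ≟ k) v l ⟩
    𝟙[ f v ≟ k ] + count f l ≡⟨ cong₂ (λ c m → 𝟙[ c ≟ k ] + m) (f≡g (here refl)) (count-agree (λ v∈l → f≡g (there v∈l))) ⟩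
    𝟙[ g v ≟ k ] + count g l ≡⟨ length-filter-∷ (λ v → g v ≟ k) v l ⟨
    count g (v ∷ l)          ∎
    where open ≡-Reasoning

  count-update : ∀ {l x} → Unique l → x ∈ l → (∀ {v} → v ≢ x → f v ≡ g v) →
                 count f l + 𝟙[ g x ≟ k ] ≡ count g l + 𝟙[ f x ≟ k ]
  count-update {x ∷ l} (x∉l ∷ _) (here refl) f≡g = begin
    count f (x ∷ l) + 𝟙[ g x ≟ k ]          ≡⟨ cong (_+ 𝟙[ g x ≟ k ]) (length-filter-∷ (λ v → f v ≟ k) x l) ⟩
    𝟙[ f x ≟ k ] + count f l + 𝟙[ g x ≟ k ] ≡⟨ cong (λ m → 𝟙[ f x ≟ k ] + m + 𝟙[ g x ≟ k ]) (count-agree (λ v∈l → f≡g (≢-sym (All.lookup x∉l v∈l)))) ⟩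
    𝟙[ f x ≟ k ] + count g l + 𝟙[ g x ≟ k ] ≡⟨ swap (𝟙[ f x ≟ k ]) (count g l) (𝟙[ g x ≟ k ]) ⟩
    𝟙[ g x ≟ k ] + count g l + 𝟙[ f x ≟ k ] ≡⟨ cong (_+ 𝟙[ f x ≟ k ]) (length-filter-∷ (λ v → g v ≟ k) x l) ⟨
    count g (x ∷ l) + 𝟙[ f x ≟ k ]          ∎
    where
    open ≡-Reasoning
    swap : ∀ a b c → a + b + c ≡ c + b + a
    swap = solve-∀
  count-update {v ∷ l} {x} (v∉l ∷ l!) (there x∈l) f≡g = begin
    count f (v ∷ l) + 𝟙[ g x ≟ k ]            ≡⟨ cong (_+ 𝟙[ g x ≟ k ]) (length-filter-∷ (λ v → f v ≟ k) v l) ⟩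
    𝟙[ f v ≟ k ] + count f l + 𝟙[ g x ≟ k ]   ≡⟨ +-assoc (𝟙[ f v ≟ k ]) _ _ ⟩
    𝟙[ f v ≟ k ] + (count f l + 𝟙[ g x ≟ k ]) ≡⟨ cong₂ (λ c m → 𝟙[ c ≟ k ] + m) (f≡g (All.lookup v∉l x∈l)) (count-update l! x∈l f≡g) ⟩
    𝟙[ g v ≟ k ] + (count g l + 𝟙[ f x ≟ k ]) ≡⟨ +-assoc (𝟙[ g v ≟ k ]) _ _ ⟨
    𝟙[ g v ≟ k ] + count g l + 𝟙[ f x ≟ k ]   ≡⟨ cong (_+ 𝟙[ f x ≟ k ]) (length-filter-∷ (λ v → g v ≟ k) v l) ⟨
    count g (v ∷ l) + 𝟙[ f x ≟ k ]            ∎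
    where open ≡-Reasoning

length-filter≡sum𝟙 : {A : Set} {P : Pred A 0ℓ} (P? : Decidable P) (xs : List A) →
                     length (filter P? xs) ≡ sum (map (λ x → 𝟙[ P? x ]) xs)
length-filter≡sum𝟙 P? [] = refl
length-filter≡sum𝟙 P? (x ∷ xs) = trans (length-filter-∷ P? x xs) (cong (𝟙[ P? x ] +_) (length-filter≡sum𝟙 P? xs))

sum𝟙-unique≤1 : ∀ {cs} k → Unique cs → sum (map (λ c → 𝟙[ c ≟ k ]) cs) ≤ 1
sum𝟙-unique≤1 {cs} k cs! = begin
  sum (map (λ c → 𝟙[ c ≟ k ]) cs) ≡⟨ length-filter≡sum𝟙 (_≟ k) cs ⟨
  length (filter (_≟ k) cs)       ≤⟨ unique-⊆⇒length≤ _≟_ {ys = k ∷ []} (Unique.filter⁺ (_≟ k) cs!) k-only ⟩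
  1                               ∎
  where
  open ≤-Reasoning
  k-only : filter (_≟ k) cs ⊆ k ∷ []
  k-only c∈ = here (proj₂ (∈-filter⁻ (_≟ k) {xs = cs} c∈))

Descending : List ℕ → Set
Descending = AllPairs _≥_

count≥ : ℕ → List ℕ → ℕ
count≥ t w = length (filter (t ≤?_) w)

count≥-below : ∀ {t w} → All (_< t) w → count≥ t w ≡ 0
count≥-below {t} w<t = cong length (filter-none (t ≤?_) (All.map <⇒≱ w<t))

LexLess-irrefl : ∀ {w} → ¬ LexLess w w
LexLess-irrefl (here a<a) = <-irrefl refl a<a
LexLess-irrefl (there p) = LexLess-irrefl p

LexLess-asym : ∀ {w w'} → LexLess w w' → ¬ LexLess w' w
LexLess-asym (here a<b) (here b<a) = <-asym a<b b<a
LexLess-asym (here a<a) (there _) = <-irrefl refl a<a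
LexLess-asym (there _) (here a<a) = <-irrefl refl a<a
LexLess-asym (there p) (there q) = LexLess-asym p q

head<⇒all< : ∀ {m w t} → Descending (m ∷ w) → m < t → All (_< t) (m ∷ w)
head<⇒all< (m≥w ∷ _) m<t = m<t ∷ All.map (λ x≤m → ≤-<-trans x≤m m<t) m≥w

lex<-by-count≥ : ∀ {w w'} → Descending w → Descending w' → length w ≤ length w' → ∀ t →
                 count≥ t w' < count≥ t w → (∀ t' → t < t' → count≥ t' w' ≡ count≥ t' w) →
                 LexLess w' w
lex<-by-count≥ {[]} _ _ _ t w'<w _ = contradiction w'<w n≮0
lex<-by-count≥ {m ∷ w} {m' ∷ w'} w↓@(_ ∷ v↓) (_ ∷ v'↓) (s≤s len) t w'<w w'≡w with <-cmp m' m
... | tri< m'<m _ _ = here m'<m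
... | tri≈ _ refl _ =
  there (lex<-by-count≥ v↓ v'↓ len t (+-cancelˡ-< _ _ _ (subst₂ _<_ (∷-count t w') (∷-count t w) w'<w))
           (λ t' t<t' → +-cancelˡ-≡ _ _ _ (trans (sym (∷-count t' w')) (trans (w'≡w t' t<t') (∷-count t' w)))))
  where
  ∷-count : ∀ t v → count≥ t (m ∷ v) ≡ 𝟙[ t ≤? m ] + count≥ t v
  ∷-count t = length-filter-∷ (t ≤?_) m
... | tri> _ _ m<m' with t <? m'
...   | yes t<m' = contradiction count≡0 1+n≢0
  where
  open ≡-Reasoning
  count≡0 : suc (count≥ m' w') ≡ 0
  count≡0 = begin
    suc (count≥ m' w')  ≡⟨ cong length (filter-accept (m' ≤?_) ≤-refl) ⟨
    count≥ m' (m' ∷ w') ≡⟨ w'≡w m' t<m' ⟩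
    count≥ m' (m ∷ w)   ≡⟨ count≥-below (head<⇒all< w↓ m<m') ⟩
    0                   ∎
...   | no t≮m' = contradiction (subst (count≥ t (m' ∷ w') <_) count≡0 w'<w) n≮0
  where
  count≡0 : count≥ t (m ∷ w) ≡ 0
  count≡0 = count≥-below (head<⇒all< w↓ (<-≤-trans m<m' (≮⇒≥ t≮m')))

lex<-of-bounded : ∀ {w w' K s} → Descending w → s ∈ w → K < s → All (_≤ K) w' → 0 < length w' → LexLess w' w
lex<-of-bounded {m ∷ w} {m' ∷ w'} (m≥w ∷ _) s∈w K<s (m'≤K ∷ _) _ = here (≤-<-trans m'≤K (<-≤-trans K<s (s≤m s∈w)))
  where
  s≤m : ∀ {s} → s ∈ m ∷ w → s ≤ m
  s≤m (here refl) = ≤-refl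
  s≤m (there s∈w) = All.lookup m≥w s∈w

reverseAcc-descending : ∀ {acc xs} → AllPairs _≤_ xs → Descending acc → All (λ a → All (a ≤_) xs) acc →
                        Descending (reverseAcc acc xs)
reverseAcc-descending {xs = []} _ acc↓ _ = acc↓
reverseAcc-descending {xs = x ∷ xs} (x≤xs ∷ xs↑) acc↓ acc≤ =
  reverseAcc-descending xs↑ (All.map All.head acc≤ ∷ acc↓) (x≤xs ∷ All.map All.tail acc≤)

_≟V_ : ∀ {n} → DecidableEquality (V n)
_≟V_ = ≡-dec Bool._≟_ Fin._≟_

∈-vertices : ∀ {n} (v : V n) → v ∈ vertices n
∈-vertices {n} (false , i) = ∈-cartesianProduct⁺ {xs = false ∷ true ∷ []} {ys = allFin n} (here refl) (∈-allFin i)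
∈-vertices {n} (true , i) = ∈-cartesianProduct⁺ {xs = false ∷ true ∷ []} {ys = allFin n} (there (here refl)) (∈-allFin i)

vertices-unique : ∀ n → Unique (vertices n)
vertices-unique n = Unique.cartesianProduct⁺ (((λ ()) ∷ []) ∷ [] ∷ []) (Unique.allFin⁺ n)

module _ {n : ℕ} (d : V n → ℕ) where

  ∈-usedColors : ∀ v → d v ∈ usedColors n d
  ∈-usedColors v = ∈-deduplicate⁺ _≟_ (∈-map⁺ d (∈-vertices v))

  usedColors-unique : Unique (usedColors n d)
  usedColors-unique = deduplicate-! _≟_ _

  used⇒classSize>0 : ∀ {k} → k ∈ usedColors n d → 0 < classSize n d k
  used⇒classSize>0 k∈used with ∈-map⁻ d (∈-deduplicate⁻ _≟_ (map d (vertices n)) k∈used)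
  ... | v , v∈V , refl = ∈-length (setoid _) (∈-filter⁺ (λ w → d w ≟ d v) v∈V refl)

  classSize>0⇒used : ∀ {k} → 0 < classSize n d k → k ∈ usedColors n d
  classSize>0⇒used {k} size>0 with colorClass n d k in eq
  ... | v ∷ _ with ∈-filter⁻ (λ w → d w ≟ k) {xs = vertices n} (subst (v ∈_) (sym eq) (here refl))
  ...   | _ , refl = ∈-usedColors v

  classSize≥2 : ∀ {v w k} → v ≢ w → d v ≡ k → d w ≡ k → 2 ≤ classSize n d k
  classSize≥2 {v} {w} {k} v≢w dv≡k dw≡k = unique-⊆⇒length≤ _≟V_ ((v≢w ∷ []) ∷ [] ∷ []) vw⊆class
    where
    vw⊆class : v ∷ w ∷ [] ⊆ colorClass n d k
    vw⊆class (here refl) = ∈-filter⁺ (λ u → d u ≟ k) (∈-vertices v) dv≡k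
    vw⊆class (there (here refl)) = ∈-filter⁺ (λ u → d u ≟ k) (∈-vertices w) dw≡k

  colorWord-↭ : colorWord n d ↭ map (classSize n d) (usedColors n d)
  colorWord-↭ = ↭-trans (↭-reverse _) (sort-↭ _)

  colorWord-descending : Descending (colorWord n d)
  colorWord-descending = reverseAcc-descending (Linked⇒AllPairs ≤-trans (sort-↗ _)) [] []

  colorWord-positive : All (0 <_) (colorWord n d)
  colorWord-positive = All-resp-↭ (↭-sym colorWord-↭) (Allₚ.map⁺ (All.tabulate used⇒classSize>0))

  length-colorWord : length (colorWord n d) ≡ count≥ 1 (colorWord n d)
  length-colorWord = cong length (sym (filter-all (1 ≤?_) colorWord-positive))

  count≥-colorWord : ∀ {S t} → Unique S → usedColors n d ⊆ S → 0 < t →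
                     count≥ t (colorWord n d) ≡ length (filter (λ k → t ≤? classSize n d k) S)
  count≥-colorWord {S} {t} S! used⊆S t>0 = begin
    count≥ t (colorWord n d)                                       ≡⟨ ↭-length (filter-↭ (t ≤?_) colorWord-↭) ⟩
    length (filter (t ≤?_) (map (classSize n d) (usedColors n d))) ≡⟨ length-filter-map (t ≤?_) (classSize n d) (usedColors n d) ⟩
    length (filter big? (usedColors n d))                          ≡⟨ ≤-antisym (unique-⊆⇒length≤ _≟_ (Unique.filter⁺ big? usedColors-unique) (filter⁺′ big? big? id used⊆S))
                                                                                  (unique-⊆⇒length≤ _≟_ (Unique.filter⁺ big? S!) big-in-S⊆used) ⟩
    length (filter big? S)                                           ∎
    where
    open ≡-Reasoning
    big? : Decidable (λ k → t ≤ classSize n d k)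
    big? k = t ≤? classSize n d k
    big-in-S⊆used : filter big? S ⊆ filter big? (usedColors n d)
    big-in-S⊆used k∈ with ∈-filter⁻ big? {xs = S} k∈
    ... | _ , t≤size = ∈-filter⁺ big? (classSize>0⇒used (<-≤-trans t>0 t≤size)) t≤size

Adj-sym : ∀ {n u v} → Adj n u v → Adj n v u
Adj-sym (inj₁ (refl , inj₁ i→j)) = inj₁ (refl , inj₂ i→j)
Adj-sym (inj₁ (refl , inj₂ j→i)) = inj₁ (refl , inj₁ j→i)
Adj-sym (inj₂ (a≢b , refl)) = inj₂ (≢-sym a≢b , refl)

CycSucc? : ∀ n i j → Dec (CycSucc n i j)
CycSucc? n i j = (suc (toℕ i) ≟ toℕ j) ⊎-dec ((suc (toℕ i) ≟ n) ×-dec (toℕ j ≟ 0))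

Adj? : ∀ n u v → Dec (Adj n u v)
Adj? n (a , i) (b , j) =
  ((a Bool.≟ b) ×-dec (CycSucc? n i j ⊎-dec CycSucc? n j i)) ⊎-dec (¬? (a Bool.≟ b) ×-dec (i Fin.≟ j))

-- A vertex (b , i) is recorded as (b , toℕ i), so that its three neighbors (successor and
-- predecessor on its cycle, and the other end of its rung) can be listed with ℕ arithmetic.
code : ∀ {n} → V n → Bool × ℕ
code (b , i) = b , toℕ i

code-injective : ∀ {n} {u v : V n} → code u ≡ code v → u ≡ v
code-injective {u = a , i} {b , j} eq with cong proj₁ eq | toℕ-injective (cong proj₂ eq)
... | refl | refl = refl

cycNext : ℕ → ℕ → ℕ
cycNext n i with suc i ≟ n
... | yes _ = 0
... | no _ = suc i

cycPrev : ℕ → ℕ → ℕ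
cycPrev n zero = n ∸ 1
cycPrev n (suc i) = i

neighborCodes : ∀ {n} → V n → List (Bool × ℕ)
neighborCodes {n} (b , i) = (b , cycNext n (toℕ i)) ∷ (b , cycPrev n (toℕ i)) ∷ (not b , toℕ i) ∷ []

≢⇒≡not : ∀ {a b : Bool} → a ≢ b → b ≡ not a
≢⇒≡not {false} {false} a≢b = contradiction refl a≢b
≢⇒≡not {false} {true} _ = refl
≢⇒≡not {true} {false} _ = refl
≢⇒≡not {true} {true} a≢b = contradiction refl a≢b

Adj⇒∈neighborCodes : ∀ {n} {u v : V n} → Adj n u v → code v ∈ neighborCodes u
Adj⇒∈neighborCodes {n} {b , i} {_ , j} (inj₁ (refl , inj₁ (inj₁ i+1≡j))) with suc (toℕ i) ≟ n
... | yes i+1≡n = contradiction (trans (sym i+1≡j) i+1≡n) (<⇒≢ (toℕ<n j))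
... | no _ = here (cong (b ,_) (sym i+1≡j))
Adj⇒∈neighborCodes {n} {b , i} {_ , j} (inj₁ (refl , inj₁ (inj₂ (i+1≡n , j≡0)))) with suc (toℕ i) ≟ n
... | yes _ = here (cong (b ,_) j≡0)
... | no i+1≢n = contradiction i+1≡n i+1≢n
Adj⇒∈neighborCodes {n} {b , i} {_ , j} (inj₁ (refl , inj₂ (inj₁ j+1≡i))) with toℕ i | j+1≡i
... | _ | refl = there (here refl)
Adj⇒∈neighborCodes {n} {b , i} {_ , j} (inj₁ (refl , inj₂ (inj₂ (j+1≡n , i≡0)))) with toℕ i | i≡0
... | _ | refl = there (here (cong (b ,_) (cong (_∸ 1) j+1≡n)))
Adj⇒∈neighborCodes {n} {b , i} {_ , .i} (inj₂ (b≢b' , refl)) = there (there (here (cong (_, toℕ i) (≢⇒≡not b≢b'))))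

unique-neighbors≤3 : ∀ {n} {y : V n} {l} → Unique l → All (Adj n y) l → length l ≤ 3
unique-neighbors≤3 {y = y} {l} l! y~l = begin
  length l            ≡⟨ length-map code l ⟨
  length (map code l) ≤⟨ unique-⊆⇒length≤ (≡-dec Bool._≟_ _≟_) (Unique.map⁺ code-injective l!) codes⊆ ⟩
  3                   ∎
  where
  open ≤-Reasoning
  codes⊆ : map code l ⊆ neighborCodes y
  codes⊆ c∈ with ∈-map⁻ code c∈
  ... | v , v∈l , refl = Adj⇒∈neighborCodes (All.lookup y~l v∈l)

∃-nonadjacent : ∀ {n} (y : V n) {l} → Unique l → 3 < length l → ∃[ v ] v ∈ l × ¬ Adj n y v
∃-nonadjacent {n} y {l} l! 3<l with any? (λ v → ¬? (Adj? n y v)) l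
... | yes ∃¬adj = find ∃¬adj
... | no ∄¬adj = contradiction (unique-neighbors≤3 l! y~l) (<⇒≱ 3<l)
  where
  y~l : All (Adj n y) l
  y~l = All.map (λ {v} → decidable-stable (Adj? n y v)) (¬Any⇒All¬ l ∄¬adj)

module _ {n : ℕ} (x : V n) (q : ℕ) (d : V n → ℕ) where

  recolor : V n → ℕ
  recolor v with v ≟V x
  ... | yes _ = q
  ... | no _ = d v

  recolor-≡ : recolor x ≡ q
  recolor-≡ with x ≟V x
  ... | yes _ = refl
  ... | no x≢x = contradiction refl x≢x

  recolor-≢ : ∀ {v} → v ≢ x → recolor v ≡ d v
  recolor-≢ {v} v≢x with v ≟V x
  ... | yes v≡x = contradiction v≡x v≢x
  ... | no _ = refl

  recolor-cases : ∀ v → recolor v ≡ q ⊎ recolor v ≡ d v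
  recolor-cases v with v ≟V x
  ... | yes _ = inj₁ refl
  ... | no _ = inj₂ refl

  recolor-proper : ∀ {L} → ProperLColoring n L d → q ∈ L x → (∀ w → Adj n x w → d w ≢ q) →
                   ProperLColoring n L recolor
  recolor-proper {L} (d∈L , d-proper) q∈L x-free = recolor∈L , recolor-proper′
    where
    recolor∈L : ∀ v → recolor v ∈ L v
    recolor∈L v with v ≟V x
    ... | yes refl = q∈L
    ... | no _ = d∈L v
    recolor-proper′ : ∀ u v → Adj n u v → recolor u ≢ recolor v
    recolor-proper′ u v u~v with u ≟V x | v ≟V x
    ... | yes refl | yes refl = λ _ → d-proper u u u~v refl
    ... | yes refl | no _ = λ q≡dv → x-free v u~v (sym q≡dv)
    ... | no _ | yes refl = x-free u (Adj-sym u~v)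
    ... | no _ | no _ = d-proper u v u~v

  classSize-recolor : ∀ k → classSize n recolor k + 𝟙[ d x ≟ k ] ≡ classSize n d k + 𝟙[ q ≟ k ]
  classSize-recolor k =
    subst (λ c → classSize n recolor k + 𝟙[ d x ≟ k ] ≡ classSize n d k + 𝟙[ c ≟ k ]) recolor-≡
      (count-update recolor d k (vertices-unique n) (∈-vertices x) recolor-≢)

module _ {n : ℕ} {x : V n} {q : ℕ} {d : V n → ℕ} (big : 2 + classSize n d q ≤ classSize n d (d x)) where

  private
    p : ℕ
    p = d x

    d' : V n → ℕ
    d' = recolor x q d

    size size' : ℕ → ℕ
    size = classSize n d
    size' = classSize n d'

    s : ℕ
    s = size p

    s≥2 : 2 ≤ s
    s≥2 = ≤-trans (m≤m+n 2 (size q)) big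

    s>0 : 0 < s
    s>0 = <-≤-trans z<s s≥2

    q≢p : q ≢ p
    q≢p refl = 1+n≰n (≤-trans (n≤1+n _) big)

    size'-p : suc (size' p) ≡ s
    size'-p = begin
      suc (size' p)        ≡⟨ +-comm 1 (size' p) ⟩
      size' p + 1          ≡⟨ cong (size' p +_) (𝟙-yes (p ≟ p) refl) ⟨
      size' p + 𝟙[ p ≟ p ] ≡⟨ classSize-recolor x q d p ⟩
      s + 𝟙[ q ≟ p ]       ≡⟨ cong (s +_) (𝟙-no (q ≟ p) q≢p) ⟩
      s + 0                ≡⟨ +-identityʳ s ⟩
      s                    ∎
      where open ≡-Reasoning

    size'-q : size' q ≡ suc (size q)
    size'-q = begin
      size' q              ≡⟨ +-identityʳ (size' q) ⟨
      size' q + 0          ≡⟨ cong (size' q +_) (𝟙-no (p ≟ q) (≢-sym q≢p)) ⟨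
      size' q + 𝟙[ p ≟ q ] ≡⟨ classSize-recolor x q d q ⟩
      size q + 𝟙[ q ≟ q ]  ≡⟨ cong (size q +_) (𝟙-yes (q ≟ q) refl) ⟩
      size q + 1           ≡⟨ +-comm (size q) 1 ⟩
      suc (size q)         ∎
      where open ≡-Reasoning

    size'-other : ∀ {k} → k ≢ p → k ≢ q → size' k ≡ size k
    size'-other {k} k≢p k≢q = begin
      size' k              ≡⟨ +-identityʳ (size' k) ⟨
      size' k + 0          ≡⟨ cong (size' k +_) (𝟙-no (p ≟ k) (≢-sym k≢p)) ⟨
      size' k + 𝟙[ p ≟ k ] ≡⟨ classSize-recolor x q d k ⟩
      size k + 𝟙[ q ≟ k ]  ≡⟨ cong (size k +_) (𝟙-no (q ≟ k) (≢-sym k≢q)) ⟩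
      size k + 0           ≡⟨ +-identityʳ (size k) ⟩
      size k               ∎
      where open ≡-Reasoning

    changed-or-same : ∀ k → (0 < size' k × size' k < s × size k ≤ s) ⊎ size' k ≡ size k
    changed-or-same k with k ≟ p | k ≟ q
    ... | yes refl | _ = inj₁ (≤-pred (subst (2 ≤_) (sym size'-p) s≥2) , ≤-reflexive size'-p , ≤-refl)
    ... | no _ | yes refl = inj₁ (subst (0 <_) (sym size'-q) z<s , subst (_< s) (sym size'-q) big , ≤-trans (m≤n+m _ 2) big)
    ... | no k≢p | no k≢q = inj₂ (size'-other k≢p k≢q)

    candidates : List ℕ
    candidates = q ∷ map d (vertices n)

    S : List ℕ
    S = deduplicate _≟_ candidates

    S! : Unique S
    S! = deduplicate-! _≟_ candidates

    used⊆S : usedColors n d ⊆ S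
    used⊆S k∈ = ∈-deduplicate⁺ _≟_ (there (∈-deduplicate⁻ _≟_ (map d (vertices n)) k∈))

    used'⊆S : usedColors n d' ⊆ S
    used'⊆S k∈ with ∈-map⁻ d' (∈-deduplicate⁻ _≟_ (map d' (vertices n)) k∈)
    ... | v , v∈V , refl with recolor-cases x q d v
    ...   | inj₁ d'v≡q = ∈-deduplicate⁺ _≟_ {xs = candidates} (here d'v≡q)
    ...   | inj₂ d'v≡dv = ∈-deduplicate⁺ _≟_ {xs = candidates} (there (subst (_∈ map d (vertices n)) (sym d'v≡dv) (∈-map⁺ d v∈V)))

    #≥ : ℕ → (V n → ℕ) → ℕ
    #≥ t e = length (filter (λ k → t ≤? classSize n e k) S)

    #≥-mono : ∀ {t t' e e'} → (∀ {k} → t ≤ classSize n e k → t' ≤ classSize n e' k) → #≥ t e ≤ #≥ t' e'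
    #≥-mono {t} {t'} {e} {e'} imp = unique-⊆⇒length≤ _≟_ (Unique.filter⁺ atLeast? S!) (filter⁺′ atLeast? atLeast'? imp id)
      where
      atLeast? : Decidable (λ k → t ≤ classSize n e k)
      atLeast? k = t ≤? classSize n e k
      atLeast'? : Decidable (λ k → t' ≤ classSize n e' k)
      atLeast'? k = t' ≤? classSize n e' k

    colorWord-length≤ : length (colorWord n d) ≤ length (colorWord n d')
    colorWord-length≤ = begin
      length (colorWord n d)    ≡⟨ length-colorWord d ⟩
      count≥ 1 (colorWord n d)  ≡⟨ count≥-colorWord d S! used⊆S z<s ⟩
      #≥ 1 d                    ≤⟨ #≥-mono nonempty ⟩
      #≥ 1 d'                   ≡⟨ count≥-colorWord d' S! used'⊆S z<s ⟨
      count≥ 1 (colorWord n d') ≡⟨ length-colorWord d' ⟨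
      length (colorWord n d')   ∎
      where
      open ≤-Reasoning
      nonempty : ∀ {k} → 0 < size k → 0 < size' k
      nonempty {k} size>0 with changed-or-same k
      ... | inj₁ (size'>0 , _) = size'>0
      ... | inj₂ same = subst (0 <_) (sym same) size>0

    count≥-at-s : count≥ s (colorWord n d') < count≥ s (colorWord n d)
    count≥-at-s = begin-strict
      count≥ s (colorWord n d') ≡⟨ count≥-colorWord d' S! used'⊆S s>0 ⟩
      #≥ s d'                   <⟨ unique-⊆-∉⇒length< _≟_ (Unique.filter⁺ big'? S!) (filter⁺′ big'? big? shrinks id) p∈big p∉big' ⟩
      #≥ s d                    ≡⟨ count≥-colorWord d S! used⊆S s>0 ⟨
      count≥ s (colorWord n d)  ∎
      where
      open ≤-Reasoning
      big? : Decidable (λ k → s ≤ size k)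
      big? k = s ≤? size k
      big'? : Decidable (λ k → s ≤ size' k)
      big'? k = s ≤? size' k
      shrinks : ∀ {k} → s ≤ size' k → s ≤ size k
      shrinks {k} s≤size' with changed-or-same k
      ... | inj₁ (_ , size'<s , _) = contradiction s≤size' (<⇒≱ size'<s)
      ... | inj₂ same = subst (s ≤_) same s≤size'
      p∈big : p ∈ filter big? S
      p∈big = ∈-filter⁺ big? (∈-deduplicate⁺ _≟_ {xs = candidates} (there (∈-map⁺ d (∈-vertices x)))) ≤-refl
      p∉big' : p ∉ filter big'? S
      p∉big' p∈big' = <⇒≱ (≤-reflexive size'-p) (proj₂ (∈-filter⁻ big'? {xs = S} p∈big'))

    count≥-above-s : ∀ t → s < t → count≥ t (colorWord n d') ≡ count≥ t (colorWord n d)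
    count≥-above-s t s<t = begin
      count≥ t (colorWord n d') ≡⟨ count≥-colorWord d' S! used'⊆S t>0 ⟩
      #≥ t d'                   ≡⟨ ≤-antisym (#≥-mono (λ {k} → to k)) (#≥-mono (λ {k} → from k)) ⟩
      #≥ t d                    ≡⟨ count≥-colorWord d S! used⊆S t>0 ⟨
      count≥ t (colorWord n d)  ∎
      where
      open ≡-Reasoning
      t>0 : 0 < t
      t>0 = <-trans s>0 s<t
      to : ∀ k → t ≤ size' k → t ≤ size k
      to k t≤size' with changed-or-same k
      ... | inj₁ (_ , size'<s , _) = contradiction t≤size' (<⇒≱ (<-trans size'<s s<t))
      ... | inj₂ same = subst (t ≤_) same t≤size'
      from : ∀ k → t ≤ size k → t ≤ size' k
      from k t≤size with changed-or-same k
      ... | inj₁ (_ , _ , size≤s) = contradiction t≤size (<⇒≱ (≤-<-trans size≤s s<t))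
      ... | inj₂ same = subst (t ≤_) (sym same) t≤size

  recolor-lex< : LexLess (colorWord n d') (colorWord n d)
  recolor-lex< = lex<-by-count≥ (colorWord-descending d) (colorWord-descending d') colorWord-length≤ s count≥-at-s count≥-above-s

data Z₃ : Set where
  z₀ z₁ z₂ : Z₃

next : Z₃ → Z₃
next z₀ = z₁
next z₁ = z₂
next z₂ = z₀

next-≢ : ∀ t → next t ≢ t
next-≢ z₀ ()
next-≢ z₁ ()
next-≢ z₂ ()

next-injective : ∀ {s t} → next s ≡ next t → s ≡ t
next-injective {z₀} {z₀} _ = refl
next-injective {z₁} {z₁} _ = refl
next-injective {z₂} {z₂} _ = refl

mod3 : ℕ → Z₃
mod3 0 = z₀
mod3 1 = z₁
mod3 2 = z₂
mod3 (suc (suc (suc i))) = mod3 i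

mod3-suc : ∀ i → mod3 (suc i) ≡ next (mod3 i)
mod3-suc 0 = refl
mod3-suc 1 = refl
mod3-suc 2 = refl
mod3-suc (suc (suc (suc i))) = mod3-suc i

mod3-*3+ : ∀ q r → mod3 (q * 3 + r) ≡ mod3 r
mod3-*3+ zero r = refl
mod3-*3+ (suc q) r = mod3-*3+ q r

-- Residue of u_{i+1} in the 3-coloring of Π_n: i mod 3, except that when n ≡ 1 (mod 3) the
-- last vertex, which would clash with u_1, gets residue 1.
residue : ℕ → ℕ → Z₃
residue n i with suc i ≟ n | mod3 n
... | yes _ | z₁ = z₁
... | _ | _ = mod3 i

residue-regular : ∀ {n i} → suc i ≢ n ⊎ mod3 n ≢ z₁ → residue n i ≡ mod3 i
residue-regular {n} {i} h with suc i ≟ n | mod3 n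
... | yes _ | z₀ = refl
... | yes _ | z₂ = refl
... | no _ | z₀ = refl
... | no _ | z₁ = refl
... | no _ | z₂ = refl
... | yes i+1≡n | z₁ with h
...   | inj₁ i+1≢n = contradiction i+1≡n i+1≢n
...   | inj₂ z₁≢z₁ = contradiction refl z₁≢z₁

residue-last : ∀ {n i} → suc i ≡ n → mod3 n ≡ z₁ → residue n i ≡ z₁
residue-last {n} {i} i+1≡n n≡1 with suc i ≟ n | mod3 n
... | yes _ | z₁ = refl
... | yes _ | z₀ = contradiction n≡1 (λ ())
... | yes _ | z₂ = contradiction n≡1 (λ ())
... | no i+1≢n | _ = contradiction i+1≡n i+1≢n

≡z₁? : ∀ t → Dec (t ≡ z₁)
≡z₁? z₀ = no (λ ())
≡z₁? z₁ = yes refl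
≡z₁? z₂ = no (λ ())

next²≡z₁⇒≢z₁ : ∀ t → next (next t) ≡ z₁ → t ≢ z₁
next²≡z₁⇒≢z₁ z₂ _ ()

next≢z₁⇒≢z₀ : ∀ t → next t ≢ z₁ → t ≢ z₀
next≢z₁⇒≢z₀ z₀ next≢z₁ _ = next≢z₁ refl

residue-cycle : ∀ {n i j} → 2 ≤ n → j < n → suc i ≡ j ⊎ (suc i ≡ n × j ≡ 0) → residue n i ≢ residue n j
residue-cycle {n} {i} _ j<n (inj₁ refl) row≡ = by-cases (suc (suc i) ≟ n) (≡z₁? (mod3 n))
  where
  i≡ : mod3 i ≡ residue n (suc i)
  i≡ = trans (sym (residue-regular (inj₁ (<⇒≢ j<n)))) row≡
  next≢ : residue n (suc i) ≡ mod3 (suc i) → ⊥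
  next≢ row≡mod3 = next-≢ (mod3 i) (sym (trans i≡ (trans row≡mod3 (mod3-suc i))))
  by-cases : Dec (suc (suc i) ≡ n) → Dec (mod3 n ≡ z₁) → ⊥
  by-cases (yes i+2≡n) (yes n≡1) =
    next²≡z₁⇒≢z₁ (mod3 i) (subst (_≡ z₁) (trans (cong mod3 (sym i+2≡n)) (trans (mod3-suc (suc i)) (cong next (mod3-suc i)))) n≡1)
      (trans i≡ (residue-last {n} {suc i} i+2≡n n≡1))
  by-cases (no i+2≢n) _ = next≢ (residue-regular {n} {suc i} (inj₁ i+2≢n))
  by-cases _ (no n≢1) = next≢ (residue-regular {n} {suc i} (inj₂ n≢1))
residue-cycle {_} {i} 2≤n _ (inj₂ (refl , refl)) row≡ = by-cases (≡z₁? (mod3 (suc i)))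
  where
  row-0 : residue (suc i) 0 ≡ z₀
  row-0 = residue-regular {suc i} {0} (inj₁ (λ 1≡n → <⇒≢ 2≤n 1≡n))
  by-cases : Dec (mod3 (suc i) ≡ z₁) → ⊥
  by-cases (yes n≡1) = contradiction (trans (sym (residue-last {suc i} {i} refl n≡1)) (trans row≡ row-0)) (λ ())
  by-cases (no n≢1) =
    next≢z₁⇒≢z₀ (mod3 i) (subst (_≢ z₁) (mod3-suc i) n≢1) (trans (sym (residue-regular {suc i} {i} (inj₂ n≢1))) (trans row≡ row-0))

Σ< : ℕ → (ℕ → ℕ) → ℕ
Σ< zero f = 0
Σ< (suc n) f = f 0 + Σ< n (λ i → f (suc i))

Σ<-+ : ∀ n f g → Σ< n (λ i → f i + g i) ≡ Σ< n f + Σ< n g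
Σ<-+ zero f g = refl
Σ<-+ (suc n) f g = trans (cong (f 0 + g 0 +_) (Σ<-+ n _ _)) (interchange (f 0) (g 0) _ _)

Σ<-cong : ∀ n {f g} → (∀ {i} → i < n → f i ≡ g i) → Σ< n f ≡ Σ< n g
Σ<-cong zero _ = refl
Σ<-cong (suc n) f≡g = cong₂ _+_ (f≡g z<s) (Σ<-cong n (λ i<n → f≡g (s<s i<n)))

Σ<-split : ∀ m r f → Σ< (m + r) f ≡ Σ< m f + Σ< r (λ i → f (m + i))
Σ<-split zero r f = refl
Σ<-split (suc m) r f = trans (cong (f 0 +_) (Σ<-split m r (λ i → f (suc i)))) (sym (+-assoc (f 0) _ _))

Σ<-≤1 : ∀ n {f} → (∀ i → f i ≤ 1) → Σ< n f ≤ n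
Σ<-≤1 zero _ = z≤n
Σ<-≤1 (suc n) f≤1 = +-mono-≤ (f≤1 0) (Σ<-≤1 n (λ i → f≤1 (suc i)))

count-allFin : ∀ {P : Pred ℕ 0ℓ} (P? : Decidable P) n →
               length (filter (λ i → P? (toℕ i)) (allFin n)) ≡ Σ< n (λ i → 𝟙[ P? i ])
count-allFin P? zero = refl
count-allFin {P} P? (suc n) = begin
  length (filter P?ᶠ (allFin (suc n)))                            ≡⟨ length-filter-∷ P?ᶠ Fin.zero (tabulate Fin.suc) ⟩
  𝟙[ P? 0 ] + length (filter P?ᶠ (tabulate Fin.suc))              ≡⟨ cong (λ xs → 𝟙[ P? 0 ] + length (filter P?ᶠ xs)) (map-tabulate id Fin.suc) ⟨
  𝟙[ P? 0 ] + length (filter P?ᶠ (map Fin.suc (allFin n)))        ≡⟨ cong (𝟙[ P? 0 ] +_) (length-filter-map P?ᶠ Fin.suc (allFin n)) ⟩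
  𝟙[ P? 0 ] + length (filter (λ i → P? (suc (toℕ i))) (allFin n)) ≡⟨ cong (𝟙[ P? 0 ] +_) (count-allFin (λ i → P? (suc i)) n) ⟩
  𝟙[ P? 0 ] + Σ< n (λ i → 𝟙[ P? (suc i) ])                        ∎
  where
  open ≡-Reasoning
  P?ᶠ : Decidable (λ (i : Fin.Fin (suc n)) → P (toℕ i))
  P?ᶠ i = P? (toℕ i)

rowsColoring : ∀ {n} → (Bool → ℕ → ℕ) → V n → ℕ
rowsColoring col (b , i) = col b (toℕ i)

classSize-rows : ∀ n col k →
  classSize n (rowsColoring col) k ≡ Σ< n (λ i → 𝟙[ col false i ≟ k ] + 𝟙[ col true i ≟ k ])
classSize-rows n col k = begin
  classSize n (rowsColoring col) k                                     ≡⟨ cong (λ vs → length (filter P? vs)) vertices-split ⟩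
  length (filter P? (row false ++ row true))                           ≡⟨ cong length (filter-++ P? (row false) (row true)) ⟩
  length (filter P? (row false) ++ filter P? (row true))               ≡⟨ length-++ (filter P? (row false)) ⟩
  length (filter P? (row false)) + length (filter P? (row true))       ≡⟨ cong₂ _+_ (count-row false) (count-row true) ⟩
  Σ< n (λ i → 𝟙[ col false i ≟ k ]) + Σ< n (λ i → 𝟙[ col true i ≟ k ]) ≡⟨ Σ<-+ n _ _ ⟨
  Σ< n (λ i → 𝟙[ col false i ≟ k ] + 𝟙[ col true i ≟ k ])              ∎
  where
  open ≡-Reasoning
  P? : Decidable (λ v → rowsColoring col v ≡ k)
  P? v = rowsColoring col v ≟ k
  row : Bool → List (V n)
  row b = map (b ,_) (allFin n)
  vertices-split : vertices n ≡ row false ++ row true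
  vertices-split = cong (row false ++_) (++-identityʳ (row true))
  count-row : ∀ b → length (filter P? (row b)) ≡ Σ< n (λ i → 𝟙[ col b i ≟ k ])
  count-row b = trans (length-filter-map P? (b ,_) (allFin n)) (count-allFin (λ i → col b i ≟ k) n)

m*n≤o⇒m≤o/n : ∀ m o n .{{_ : NonZero n}} → m * n ≤ o → m ≤ o / n
m*n≤o⇒m≤o/n m o n m*n≤o = subst (_≤ o / n) (m*n/n≡m m n) (/-monoˡ-≤ n m*n≤o)

periodic-bound : ∀ q r → r < 3 → q * 2 + r ≤ ceil2n/3 (q * 3 + r)
periodic-bound q r r<3 = m*n≤o⇒m≤o/n (q * 2 + r) _ 3 (bound r r<3)
  where
  bound : ∀ r → r < 3 → (q * 2 + r) * 3 ≤ 2 * (q * 3 + r) + 2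
  bound 0 _ = subst ((q * 2 + 0) * 3 ≤_) (eq₀ q) (m≤m+n _ 2)
    where eq₀ : ∀ q → (q * 2 + 0) * 3 + 2 ≡ 2 * (q * 3 + 0) + 2
          eq₀ = solve-∀
  bound 1 _ = subst ((q * 2 + 1) * 3 ≤_) (eq₁ q) (m≤m+n _ 1)
    where eq₁ : ∀ q → (q * 2 + 1) * 3 + 1 ≡ 2 * (q * 3 + 1) + 2
          eq₁ = solve-∀
  bound 2 _ = ≤-reflexive (eq₂ q)
    where eq₂ : ∀ q → (q * 2 + 2) * 3 ≡ 2 * (q * 3 + 2) + 2
          eq₂ = solve-∀
  bound (suc (suc (suc _))) (s≤s (s≤s (s≤s ())))

residue-periodic : ∀ q r {i} → i < q * 3 → residue (q * 3 + r) i ≡ mod3 i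
residue-periodic q zero {i} _ =
  residue-regular {q * 3 + 0} {i} (inj₂ (λ n≡1 → contradiction (trans (sym (mod3-*3+ q 0)) n≡1) (λ ())))
residue-periodic q (suc r) i<q3 = residue-regular (inj₁ (<⇒≢ (≤-<-trans i<q3 (m<m+n (q * 3) z<s))))

module _ {u₀ u₁ u₂ : ℕ} (u₀≢u₁ : u₀ ≢ u₁) (u₀≢u₂ : u₀ ≢ u₂) (u₁≢u₂ : u₁ ≢ u₂) where

  private
    colors : List ℕ
    colors = u₀ ∷ u₁ ∷ u₂ ∷ []

    color : Z₃ → ℕ
    color z₀ = u₀
    color z₁ = u₁
    color z₂ = u₂

    color∈ : ∀ t → color t ∈ colors
    color∈ z₀ = here refl
    color∈ z₁ = there (here refl)
    color∈ z₂ = there (there (here refl))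

    color-injective : ∀ {s t} → color s ≡ color t → s ≡ t
    color-injective {z₀} {z₀} _ = refl
    color-injective {z₁} {z₁} _ = refl
    color-injective {z₂} {z₂} _ = refl
    color-injective {z₀} {z₁} eq = contradiction eq u₀≢u₁
    color-injective {z₀} {z₂} eq = contradiction eq u₀≢u₂
    color-injective {z₁} {z₂} eq = contradiction eq u₁≢u₂
    color-injective {z₁} {z₀} eq = contradiction (sym eq) u₀≢u₁
    color-injective {z₂} {z₀} eq = contradiction (sym eq) u₀≢u₂
    color-injective {z₂} {z₁} eq = contradiction (sym eq) u₁≢u₂

    rowColor : Bool → Z₃ → ℕ
    rowColor false t = color t
    rowColor true t = color (next t)

    rowColor-injective : ∀ b {s t} → rowColor b s ≡ rowColor b t → s ≡ t
    rowColor-injective false eq = color-injective eq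
    rowColor-injective true eq = next-injective (color-injective eq)

    balanced : ∀ n → V n → ℕ
    balanced n = rowsColoring (λ b i → rowColor b (residue n i))

    balanced-proper : ∀ {n} → 2 ≤ n → ∀ u v → Adj n u v → balanced n u ≢ balanced n v
    balanced-proper 2≤n (b , i) (_ , j) (inj₁ (refl , inj₁ i→j)) eq =
      residue-cycle 2≤n (toℕ<n j) i→j (rowColor-injective b eq)
    balanced-proper 2≤n (b , i) (_ , j) (inj₁ (refl , inj₂ j→i)) eq =
      residue-cycle 2≤n (toℕ<n i) j→i (sym (rowColor-injective b eq))
    balanced-proper _ (false , _) (false , _) (inj₂ (f≢f , refl)) = contradiction refl f≢f
    balanced-proper _ (true , _) (true , _) (inj₂ (t≢t , refl)) = contradiction refl t≢t
    balanced-proper _ (false , _) (true , _) (inj₂ (_ , refl)) eq = next-≢ _ (sym (color-injective eq))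
    balanced-proper _ (true , _) (false , _) (inj₂ (_ , refl)) eq = next-≢ _ (color-injective eq)

    pairCount : ℕ → Z₃ → ℕ
    pairCount k t = 𝟙[ color t ≟ k ] + 𝟙[ color (next t) ≟ k ]

    pairCount≤1 : ∀ k t → pairCount k t ≤ 1
    pairCount≤1 k t = subst (_≤ 1) (cong (𝟙[ color t ≟ k ] +_) (+-identityʳ _)) (sum𝟙-unique≤1 k ((distinct ∷ []) ∷ [] ∷ []))
      where
      distinct : color t ≢ color (next t)
      distinct eq = next-≢ t (sym (color-injective eq))

    -- Over a full period every color is used exactly twice, once in each row.
    pairCount-period : ∀ k → pairCount k z₀ + pairCount k z₁ + pairCount k z₂ ≤ 2
    pairCount-period k = subst (_≤ 2) (twice (𝟙[ u₀ ≟ k ]) (𝟙[ u₁ ≟ k ]) (𝟙[ u₂ ≟ k ]))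
                           (*-monoʳ-≤ 2 (sum𝟙-unique≤1 k colors!))
      where
      colors! : Unique colors
      colors! = (u₀≢u₁ ∷ u₀≢u₂ ∷ []) ∷ (u₁≢u₂ ∷ []) ∷ [] ∷ []
      twice : ∀ a b c → 2 * (a + (b + (c + 0))) ≡ a + b + (b + c) + (c + a)
      twice = solve-∀

    pairCount-mod3 : ∀ k q → Σ< (q * 3) (λ i → pairCount k (mod3 i)) ≤ q * 2
    pairCount-mod3 k zero = z≤n
    pairCount-mod3 k (suc q) = subst (_≤ 2 + q * 2) (regroup (pairCount k z₀) (pairCount k z₁) (pairCount k z₂) _)
                                 (+-mono-≤ (pairCount-period k) (pairCount-mod3 k q))
      where
      regroup : ∀ a b c m → a + b + c + m ≡ a + (b + (c + m))
      regroup = solve-∀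

    pairCount-residue : ∀ k q r → r < 3 →
                        Σ< (q * 3 + r) (λ i → pairCount k (residue (q * 3 + r) i)) ≤ ceil2n/3 (q * 3 + r)
    pairCount-residue k q r r<3 = begin
      Σ< (q * 3 + r) f                            ≡⟨ Σ<-split (q * 3) r f ⟩
      Σ< (q * 3) f + Σ< r (λ i → f (q * 3 + i))   ≤⟨ +-mono-≤ (≤-reflexive periodic) (Σ<-≤1 r (λ i → pairCount≤1 k (residue (q * 3 + r) (q * 3 + i)))) ⟩
      Σ< (q * 3) (λ i → pairCount k (mod3 i)) + r ≤⟨ +-monoˡ-≤ r (pairCount-mod3 k q) ⟩
      q * 2 + r                                   ≤⟨ periodic-bound q r r<3 ⟩
      ceil2n/3 (q * 3 + r)                        ∎
      where
      open ≤-Reasoning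
      f : ℕ → ℕ
      f i = pairCount k (residue (q * 3 + r) i)
      periodic : Σ< (q * 3) f ≡ Σ< (q * 3) (λ i → pairCount k (mod3 i))
      periodic = Σ<-cong (q * 3) (λ i<q3 → cong (pairCount k) (residue-periodic q r i<q3))

    balanced-bounded : ∀ n → Bounded n (ceil2n/3 n) (balanced n)
    balanced-bounded n k = begin
      classSize n (balanced n) k             ≡⟨ classSize-rows n (λ b i → rowColor b (residue n i)) k ⟩
      Σ< n (λ i → pairCount k (residue n i)) ≤⟨ subst P (sym n≡) (pairCount-residue k (n / 3) (n % 3) (m%n<n n 3)) ⟩
      ceil2n/3 n                             ∎
      where
      open ≤-Reasoning
      P : ℕ → Set
      P m = Σ< m (λ i → pairCount k (residue m i)) ≤ ceil2n/3 m
      n≡ : n ≡ n / 3 * 3 + n % 3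
      n≡ = trans (m≡m%n+[m/n]*n n 3) (+-comm (n % 3) _)

    rowColor∈ : ∀ b t → rowColor b t ∈ colors
    rowColor∈ false t = color∈ t
    rowColor∈ true t = color∈ (next t)

  balanced-coloring-distinct : ∀ {n} → 2 ≤ n →
                               ∃[ d ] ProperLColoring n (λ _ → u₀ ∷ u₁ ∷ u₂ ∷ []) d × Bounded n (ceil2n/3 n) d
  balanced-coloring-distinct {n} 2≤n =
    balanced n , ((λ (b , i) → rowColor∈ b (residue n (toℕ i))) , balanced-proper 2≤n) , balanced-bounded n

balanced-coloring : ∀ {n cs} → 2 ≤ n → length cs ≡ 3 → Unique cs →
                    ∃[ d ] ProperLColoring n (λ _ → cs) d × Bounded n (ceil2n/3 n) d
balanced-coloring {cs = u₀ ∷ u₁ ∷ u₂ ∷ []} 2≤n refl ((u₀≢u₁ ∷ u₀≢u₂ ∷ []) ∷ (u₁≢u₂ ∷ []) ∷ [] ∷ []) =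
  balanced-coloring-distinct u₀≢u₁ u₀≢u₂ u₁≢u₂ 2≤n

ceil2n/3≥4 : ∀ {n} → 6 ≤ n → 4 ≤ ceil2n/3 n
ceil2n/3≥4 {n} 6≤n = m*n≤o⇒m≤o/n 4 (2 * n + 2) 3 (≤-trans (*-monoʳ-≤ 2 6≤n) (m≤m+n (2 * n) 2))

ProperLColoring-⊆ : ∀ {n L L'} {d : V n → ℕ} → (∀ v → L v ⊆ L' v) → ProperLColoring n L d → ProperLColoring n L' d
ProperLColoring-⊆ L⊆L' (d∈L , d-proper) = (λ v → L⊆L' v (d∈L v)) , d-proper

LexMin⇒¬lex< : ∀ {n L} {c d : V n → ℕ} → LexMin n L c → ProperLColoring n L d → ¬ LexLess (colorWord n d) (colorWord n c)
LexMin⇒¬lex< {n} {c = c} {d} c-min d-proper d<c with c-min d d-proper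
... | inj₁ c≡d = LexLess-irrefl (subst (λ w → LexLess w (colorWord n c)) (sym c≡d) d<c)
... | inj₂ c<d = LexLess-asym d<c c<d

classSize∈colorWord : ∀ {n} (d : V n → ℕ) {k} → 0 < classSize n d k → classSize n d k ∈ colorWord n d
classSize∈colorWord d size>0 = ∈-resp-↭ (↭-sym (colorWord-↭ d)) (∈-map⁺ (classSize _ d) (classSize>0⇒used d size>0))

bounded-lex< : ∀ {n B a} {c d : V n → ℕ} → V n → Bounded n B d → B < classSize n c a →
               LexLess (colorWord n d) (colorWord n c)
bounded-lex< {c = c} {d} v d-bounded B<size =
  lex<-of-bounded (colorWord-descending c) (classSize∈colorWord c (≤-<-trans z≤n B<size)) B<size
    (All-resp-↭ (↭-sym (colorWord-↭ d)) (Allₚ.map⁺ (All.tabulate (λ {k} _ → d-bounded k))))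
    (∈-length (setoid ℕ) (classSize∈colorWord d (used⇒classSize>0 d (∈-usedColors d v))))

module _ {n : ℕ} {L : V n → List ℕ} {c : V n → ℕ}
         (L-uniform : ThreeUniform n L) (c-proper : ProperLColoring n L c) (c-min : LexMin n L c) where

  no-improving-recolor : ∀ x q → q ∈ L x → (∀ w → Adj n x w → c w ≢ q) → 2 + classSize n c q ≤ classSize n c (c x) → ⊥
  no-improving-recolor x q q∈L x-free big = LexMin⇒¬lex< c-min (recolor-proper x q c c-proper q∈L x-free) (recolor-lex< big)

  list⊆used : ∀ x → 2 ≤ classSize n c (c x) → L x ⊆ usedColors n c
  list⊆used x 2≤size {e} e∈L with e ∈? usedColors n c
  ... | yes e∈used = e∈used
  ... | no e∉used = ⊥-elim (no-improving-recolor x e e∈L e-free (subst (λ m → 2 + m ≤ classSize n c (c x)) (sym size≡0) 2≤size))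
    where
    e-free : ∀ w → Adj n x w → c w ≢ e
    e-free w _ cw≡e = e∉used (subst (_∈ usedColors n c) cw≡e (∈-usedColors c w))
    size≡0 : classSize n c e ≡ 0
    size≡0 = n≤0⇒n≡0 (≮⇒≥ (λ size>0 → e∉used (classSize>0⇒used c size>0)))

  module _ {a : ℕ} (6≤n : 6 ≤ n) (K<size : ceil2n/3 n < classSize n c a) (few : length (usedColors n c) ≤ 3) where

    used⊆list : ∀ x → 2 ≤ classSize n c (c x) → usedColors n c ⊆ L x
    used⊆list x 2≤size =
      unique-⊆-length≤⇒⊇ _≟_ (proj₂ (L-uniform x)) (list⊆used x 2≤size) (subst (_ ≤_) (sym (proj₁ (L-uniform x))) few)

    5≤size : 5 ≤ classSize n c a
    5≤size = ≤-trans (s≤s (ceil2n/3≥4 6≤n)) K<size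

    recolor-towards-singleton : ∀ y x → classSize n c (c y) < 2 → c x ≡ a → ¬ Adj n y x → ⊥
    recolor-towards-singleton y x size<2 refl y≁x =
      no-improving-recolor x (c y) (used⊆list x (≤-trans (s≤s (s≤s z≤n)) 5≤size) (∈-usedColors c y)) x-free big
      where
      x-free : ∀ w → Adj n x w → c w ≢ c y
      x-free w x~w cw≡cy with w ≟V y
      ... | yes refl = y≁x (Adj-sym x~w)
      ... | no w≢y = <⇒≱ size<2 (classSize≥2 c w≢y cw≡cy refl)
      big : 2 + classSize n c (c y) ≤ classSize n c (c x)
      big = ≤-trans (+-monoʳ-≤ 2 (≤-pred size<2)) (≤-trans (s≤s (s≤s (s≤s z≤n))) 5≤size)

    no-singleton-class : ∀ y → 2 ≤ classSize n c (c y)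
    no-singleton-class y with 2 ≤? classSize n c (c y)
    ... | yes 2≤size = 2≤size
    ... | no 2≰size with ∃-nonadjacent y (Unique.filter⁺ (λ v → c v ≟ a) (vertices-unique n)) (≤-trans (s≤s (s≤s (s≤s (s≤s z≤n)))) 5≤size)
    ...   | x , x∈A , y≁x = ⊥-elim (recolor-towards-singleton y x (≰⇒> 2≰size) (proj₂ (∈-filter⁻ (λ v → c v ≟ a) {xs = vertices n} x∈A)) y≁x)

    private
      v₀ : V n
      v₀ = false , Fin.fromℕ< (≤-trans (s≤s z≤n) 6≤n)

    better-coloring : ∃[ d ] ProperLColoring n L d × LexLess (colorWord n d) (colorWord n c)
    better-coloring with balanced-coloring (≤-trans (s≤s (s≤s z≤n)) 6≤n) (proj₁ (L-uniform v₀)) (proj₂ (L-uniform v₀))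
    ... | d , d-proper , d-bounded = d , ProperLColoring-⊆ L₀⊆L d-proper , bounded-lex< v₀ d-bounded K<size
      where
      L₀⊆L : ∀ v → L v₀ ⊆ L v
      L₀⊆L v = used⊆list v (no-singleton-class v) ∘ list⊆used v₀ (no-singleton-class v₀)

lemma4p2 : (n : ℕ) → 6 ≤ n → (L : V n → List ℕ) → ThreeUniform n L →
    (c : V n → ℕ) → ProperLColoring n L c → LexMin n L c →
    NotBounded n (ceil2n/3 n) c →
    4 ≤ length (usedColors n c)
lemma4p2 n 6≤n L L-uniform c c-proper c-min (a , K<size) with 4 ≤? length (usedColors n c)
... | yes 4≤used = 4≤used
... | no 4≰used with better-coloring L-uniform c-proper c-min 6≤n K<size (≤-pred (≰⇒> 4≰used))
...   | d , d-proper , d<c = ⊥-elim (LexMin⇒¬lex< c-min d-proper d<c)
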